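{- Let $\ell,m,n$ be positive integers, and let $A_1,\dots,A_m,B_1,\dots,B_m\subset [n]$ be such that $\ell\nmid|A_{i}\cap B_{i}|$ for every $i\in [m]$, but $\ell$ divides $|A_{i}\cap B_{j}|$ for all $i\neq j$. Then $m\leq sn$, where $s$ is the number of distinct prime divisors of $\ell$. -}

module Defs where

open import Data.Nat using (ℕ; suc)
open import Data.Nat.Primality using (prime?)
open import Data.Nat.Divisibility using (_∣?_)
open import Data.List using (List; filter; upTo; length)
open import Relation.Nullary.Decidable using (_×-dec_)

primeDivisors : ℕ → List ℕ
primeDivisors ℓ = filter (λ p → prime? p ×-dec p ∣? ℓ) (upTo (suc ℓ))

numPrimeDivisors : ℕ → ℕ
numPrimeDivisors ℓ = length (primeDivisors ℓ)

-- Since ℓ ∤ |Aᵢ ∩ Bᵢ|, some prime power p^a ∣ ℓ does not divide |Aᵢ ∩ Bᵢ|; it suffices that at most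
-- n indices i share the same prime p. If k > n of them did, the indicator vectors of their sets Aᵢ
-- would satisfy an integer relation Σ cᵢ 1_{Aᵢ} = 0 with some c_j not divisible by p. Pairing it
-- with 1_{B_j} gives Σ cᵢ |Aᵢ ∩ B_j| = 0, in which ℓ, hence the prime power p^a attached to j,
-- divides every term with i ≠ j; so p^a divides c_j |A_j ∩ B_j|, hence |A_j ∩ B_j|, a contradiction.

module Submission where

open import Data.Bool using (true; false; if_then_else_)
open import Data.Fin using (Fin; zero; suc; punchIn)
open import Data.Fin.Properties using (all?; ¬∀⟶∃¬; punchInᵢ≢i)
open import Data.Fin.Subset using (Subset; _∩_; ∣_∣)
open import Data.Integer as ℤ using (ℤ; 0ℤ; 1ℤ; _+_; _*_; -_; _-_)
import Data.Integer.Divisibility.Signed as Signed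
import Data.Integer.Properties as ℤ
open import Data.Integer.Tactic.RingSolver using (solve-∀)
open import Algebra.Properties.Semiring.Sum ℤ.+-*-semiring
  using (sum; sum-remove; ∑-comm; ∑-distrib-+; sum-cong-≗; sum-replicate-zero; *-distribˡ-sum; *-distribʳ-sum)
open import Data.List using (List; []; _∷_; length; filter; lookup; upTo)
open import Data.List.Membership.Propositional using (_∈_)
open import Data.List.Membership.Propositional.Properties using (∈-filter⁺; ∈-filter⁻; ∈-upTo⁺; ∈-lookup)
open import Data.List.Properties using (length-tabulate)
open import Data.List.Relation.Unary.All as All using (All; []; _∷_)
import Data.List.Relation.Unary.All.Properties as All
open import Data.List.Relation.Unary.Any using (here; there)
open import Data.List.Relation.Unary.Unique.Propositional using (Unique; _∷_)
import Data.List.Relation.Unary.Unique.Propositional.Properties as Unique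
open import Data.Nat as ℕ using (ℕ; zero; suc; _≤_; _<_; _^_; NonZero; nonTrivial⇒≢1)
open import Data.Nat.Divisibility as ℕ using (_∣_; _∤_; divides; _∣?_; 1∣_; ∣-trans; m∣m*n; n∣m*n; *-monoʳ-∣; *-cancelˡ-∣)
import Data.Nat.Induction as ℕ
open import Data.Nat.ListAction using (product)
open import Data.Nat.Primality using (Prime; prime?; euclidsLemma; prime⇒nonZero; prime⇒nonTrivial; prime⇒irreducible)
open import Data.Nat.Primality.Factorisation using (factorise; PrimeFactorisation)
import Data.Nat.Properties as ℕ
import Data.Nat.Tactic.RingSolver as ℕ
open import Data.Product using (∃-syntax; _×_; _,_; proj₁; proj₂)
open import Data.Sum using (inj₁; inj₂)
open import Data.Vec using (_∷_)
import Data.Vec as Vec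
open import Data.Vec.Functional using (insertAt; removeAt)
open import Data.Vec.Functional.Properties using (insertAt-lookup; insertAt-punchIn)
open import Function using (_∘_)
open import Function.Definitions using (Injective)
open import Induction.WellFounded using (Acc; acc)
open import Relation.Binary.Definitions using (DecidableEquality)
open import Relation.Binary.PropositionalEquality
open import Relation.Nullary using (¬_; Dec; yes; no; ¬?; contradiction)
open import Relation.Nullary.Decidable using (_×-dec_)

open import Defs

private variable k m n : ℕ

dot : (Fin k → ℤ) → (Fin k → ℤ) → ℤ
dot f g = sum (λ t → f t * g t)

dot-*ˡ : ∀ r (f g : Fin k → ℤ) → dot (λ t → r * f t) g ≡ r * dot f g
dot-*ˡ r f g = trans (sum-cong-≗ (λ t → ℤ.*-assoc r (f t) (g t)))
                     (sym (*-distribˡ-sum r (λ t → f t * g t)))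

dot-zeroʳ : (f : Fin k → ℤ) → dot f (λ _ → 0ℤ) ≡ 0ℤ
dot-zeroʳ {k} f = trans (sum-cong-≗ (λ t → ℤ.*-zeroʳ (f t))) (sum-replicate-zero k)

dot-linearʳ : ∀ r s (f g h : Fin k → ℤ) →
              dot f (λ t → r * g t - s * h t) ≡ r * dot f g - s * dot f h
dot-linearʳ r s f g h = begin
  dot f (λ t → r * g t - s * h t)                          ≡⟨ sum-cong-≗ (λ t → expand r s (f t) (g t) (h t)) ⟩
  sum (λ t → r * (f t * g t) + - s * (f t * h t))           ≡⟨ ∑-distrib-+ (λ t → r * (f t * g t)) (λ t → - s * (f t * h t)) ⟩
  sum (λ t → r * (f t * g t)) + sum (λ t → - s * (f t * h t)) ≡⟨ sym (cong₂ _+_ (*-distribˡ-sum r (λ t → f t * g t)) (*-distribˡ-sum (- s) (λ t → f t * h t))) ⟩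
  r * dot f g + - s * dot f h                               ≡⟨ cong (r * dot f g +_) (sym (ℤ.neg-distribˡ-* s (dot f h))) ⟩
  r * dot f g - s * dot f h                                 ∎
  where
  open ≡-Reasoning
  expand : ∀ r s a b c → a * (r * b - s * c) ≡ r * (a * b) + - s * (a * c)
  expand = solve-∀

dot-insertAt : ∀ (f : Fin k → ℤ) i a (g : Fin (suc k) → ℤ) →
               dot (insertAt f i a) g ≡ a * g i + dot f (removeAt g i)
dot-insertAt f i a g = trans (sum-remove {i = i} (λ t → insertAt f i a t * g t))
  (cong₂ _+_ (cong (_* g i) (insertAt-lookup f i a))
             (sum-cong-≗ (λ j → cong (_* g (punchIn i j)) (insertAt-punchIn f i a j))))

IsRelation : (Fin k → ℤ) → (Fin k → Fin n → ℤ) → Set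
IsRelation c v = ∀ x → dot c (λ t → v t x) ≡ 0ℤ

LinearlyDependent : (Fin k → Fin n → ℤ) → Set
LinearlyDependent v = ∃[ c ] IsRelation c v × ∃[ t ] c t ≢ 0ℤ

dependent-zero-column : (v : Fin k → Fin (suc n) → ℤ) → (∀ t → v t zero ≡ 0ℤ) →
                        LinearlyDependent (λ t → v t ∘ suc) → LinearlyDependent v
dependent-zero-column v col₀ (c , rel , nz) = c , rel′ , nz
  where
  rel′ : IsRelation c v
  rel′ zero    = trans (sum-cong-≗ (λ t → cong (c t *_) (col₀ t))) (dot-zeroʳ c)
  rel′ (suc x) = rel x

-- Row j is v t₀ zero · v j′ − v j′ zero · v t₀ (with j′ = punchIn t₀ j), whose first coordinate
-- vanishes and is dropped.
eliminate : (v : Fin (suc k) → Fin (suc n) → ℤ) → Fin (suc k) → Fin k → Fin n → ℤ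
eliminate v t₀ j x = v t₀ zero * v (punchIn t₀ j) (suc x) - v t₀ (suc x) * v (punchIn t₀ j) zero

dependent-eliminate : (v : Fin (suc k) → Fin (suc n) → ℤ) (t₀ : Fin (suc k)) → v t₀ zero ≢ 0ℤ →
                      LinearlyDependent (eliminate v t₀) → LinearlyDependent v
dependent-eliminate v t₀ d≢0 (c′ , rel , j , c′ⱼ≢0) = c , rel′ , punchIn t₀ j , cⱼ≢0
  where
  d = v t₀ zero
  coordinate : Fin _ → Fin _ → ℤ
  coordinate x j = v (punchIn t₀ j) x
  S = dot c′ (coordinate zero)
  c = insertAt (λ j → d * c′ j) t₀ (- S)

  expand : ∀ x → dot c (λ t → v t x) ≡ - S * v t₀ x + d * dot c′ (coordinate x)
  expand x = trans (dot-insertAt (λ j → d * c′ j) t₀ (- S) (λ t → v t x))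
                   (cong (- S * v t₀ x +_) (dot-*ˡ d c′ (coordinate x)))

  rel′ : IsRelation c v
  rel′ zero    = trans (expand zero) (cancel S d)
    where cancel : ∀ S d → - S * d + d * S ≡ 0ℤ
          cancel = solve-∀
  rel′ (suc x) = begin
    dot c (λ t → v t (suc x))                     ≡⟨ expand (suc x) ⟩
    - S * b + d * dot c′ (coordinate (suc x))     ≡⟨ reorder S b d _ ⟩
    d * dot c′ (coordinate (suc x)) - b * S       ≡⟨ sym (dot-linearʳ d b c′ (coordinate (suc x)) (coordinate zero)) ⟩
    dot c′ (λ j → eliminate v t₀ j x)             ≡⟨ rel x ⟩
    0ℤ                                            ∎
    where
    open ≡-Reasoning
    b = v t₀ (suc x)
    reorder : ∀ S b d T → - S * b + d * T ≡ d * T - b * S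
    reorder = solve-∀

  cⱼ≢0 : c (punchIn t₀ j) ≢ 0ℤ
  cⱼ≢0 eq with ℤ.i*j≡0⇒i≡0∨j≡0 d (trans (sym (insertAt-punchIn (λ j → d * c′ j) t₀ (- S) j)) eq)
  ... | inj₁ d≡0   = d≢0 d≡0
  ... | inj₂ c′ⱼ≡0 = c′ⱼ≢0 c′ⱼ≡0

<⇒dependent : n < k → (v : Fin k → Fin n → ℤ) → LinearlyDependent v
<⇒dependent {zero}  {suc k} _           v = (λ _ → 1ℤ) , (λ ()) , zero , λ ()
<⇒dependent {suc n} {suc k} (ℕ.s<s n<k) v with all? (λ t → v t zero ℤ.≟ 0ℤ)
... | yes col₀ = dependent-zero-column v col₀ (<⇒dependent (ℕ.m<n⇒m<1+n n<k) (λ t → v t ∘ suc))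
... | no ¬col₀ with t₀ , d≢0 ← ¬∀⟶∃¬ _ _ (λ t → v t zero ℤ.≟ 0ℤ) ¬col₀ =
  dependent-eliminate v t₀ d≢0 (<⇒dependent n<k (eliminate v t₀))

relation-divide : ∀ {v : Fin k → Fin n → ℤ} {c} r .{{_ : ℤ.NonZero r}} q →
                  (∀ t → c t ≡ q t * r) → IsRelation c v → IsRelation q v
relation-divide {v = v} {c} r q c≡qr rel x = ℤ.*-cancelˡ-≡ r (dot q column) 0ℤ (begin
  r * dot q column              ≡⟨ sym (dot-*ˡ r q column) ⟩
  dot (λ t → r * q t) column    ≡⟨ sum-cong-≗ (λ t → cong (_* v t x) (trans (ℤ.*-comm r (q t)) (sym (c≡qr t)))) ⟩
  dot c column                  ≡⟨ rel x ⟩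
  0ℤ                            ≡⟨ sym (ℤ.*-zeroʳ r) ⟩
  r * 0ℤ                        ∎)
  where
  open ≡-Reasoning
  column = λ t → v t x

PrimitiveRelation : ℕ → (Fin k → Fin n → ℤ) → Set
PrimitiveRelation p v = ∃[ c ] IsRelation c v × ∃[ t ] p ∤ ℤ.∣ c t ∣

-- Descent on ∣ c t ∣: while p divides every coefficient, divide the relation by p.
dependent⇒primitiveRelation : ∀ p .{{_ : ℕ.NonTrivial p}} (v : Fin k → Fin n → ℤ) → LinearlyDependent v →
                              PrimitiveRelation p v
dependent⇒primitiveRelation {k} p v (c , rel , t , cₜ≢0) = go c rel cₜ≢0 (ℕ.<-wellFounded ℤ.∣ c t ∣)
  where
  instance _ = ℕ.nonTrivial⇒nonZero p
  go : ∀ c → IsRelation c v → c t ≢ 0ℤ → Acc ℕ._<_ ℤ.∣ c t ∣ → PrimitiveRelation p v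
  go c rel cₜ≢0 (acc smaller) with all? (λ s → p ∣? ℤ.∣ c s ∣)
  ... | no ¬p∣c = c , rel , ¬∀⟶∃¬ k _ (λ s → p ∣? ℤ.∣ c s ∣) ¬p∣c
  ... | yes p∣c = go q (relation-divide (ℤ.+ p) q c≡qp rel) qₜ≢0 (smaller ∣qₜ∣<∣cₜ∣)
    where
    +p∣c : ∀ s → ℤ.+ p Signed.∣ c s
    +p∣c s = Signed.∣ᵤ⇒∣ (p∣c s)
    q : Fin k → ℤ
    q s = Signed._∣_.quotient (+p∣c s)
    c≡qp : ∀ s → c s ≡ q s * ℤ.+ p
    c≡qp s = Signed._∣_.equality (+p∣c s)
    qₜ≢0 : q t ≢ 0ℤ
    qₜ≢0 qₜ≡0 = cₜ≢0 (trans (c≡qp t) (cong (_* ℤ.+ p) qₜ≡0))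
    ∣qₜ∣<∣cₜ∣ : ℤ.∣ q t ∣ ℕ.< ℤ.∣ c t ∣
    ∣qₜ∣<∣cₜ∣ = begin-strict
      ℤ.∣ q t ∣          <⟨ ℕ.m<m*n ℤ.∣ q t ∣ p {{ℤ.≢-nonZero qₜ≢0}} (ℕ.nonTrivial⇒n>1 p) ⟩
      ℤ.∣ q t ∣ ℕ.* p    ≡⟨ ℤ.abs-* (q t) (ℤ.+ p) ⟨
      ℤ.∣ q t * ℤ.+ p ∣  ≡⟨ cong ℤ.∣_∣ (c≡qp t) ⟨
      ℤ.∣ c t ∣          ∎
      where open ℕ.≤-Reasoning

prime∤prime : ∀ {p q} → Prime p → Prime q → p ≢ q → p ∤ q
prime∤prime pp pq p≢q p∣q with prime⇒irreducible pq p∣q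
... | inj₁ p≡1 = nonTrivial⇒≢1 {{prime⇒nonTrivial pp}} p≡1
... | inj₂ p≡q = p≢q p≡q

prime^-divisor : ∀ {p m n} a → Prime p → p ∤ m → p ^ a ∣ m ℕ.* n → p ^ a ∣ n
prime^-divisor {n = n} zero    pp p∤m _ = 1∣ n
prime^-divisor {p} {m} {n} (suc a) pp p∤m pᵃ⁺¹∣mn
  with euclidsLemma m n pp (∣-trans (m∣m*n (p ^ a)) pᵃ⁺¹∣mn)
... | inj₁ p∣m = contradiction p∣m p∤m
... | inj₂ (divides n′ refl) =
  subst (p ^ suc a ∣_) (ℕ.*-comm p n′) (*-monoʳ-∣ p (prime^-divisor a pp p∤m pᵃ∣mn′))
  where
  instance _ = prime⇒nonZero pp
  pᵃ∣mn′ : p ^ a ∣ m ℕ.* n′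
  pᵃ∣mn′ = *-cancelˡ-∣ p (subst (p ^ suc a ∣_) (rearrange m n′ p) pᵃ⁺¹∣mn)
    where rearrange : ∀ m n p → m ℕ.* (n ℕ.* p) ≡ p ℕ.* (m ℕ.* n)
          rearrange = ℕ.solve-∀

record PrimePowerWitness (ℓ x : ℕ) : Set where
  constructor primePowerWitness
  field
    {p a}   : ℕ
    p-prime : Prime p
    pᵃ∣ℓ    : p ^ a ∣ ℓ
    pᵃ∤x    : p ^ a ∤ x

primePowerWitness-*-prime : ∀ {p m n} → Prime p → PrimePowerWitness m n → PrimePowerWitness (p ℕ.* m) (n ℕ.* p)
primePowerWitness-*-prime {p} {m} {n} pp (primePowerWitness {q} {a} pq qᵃ∣m qᵃ∤n) with q ℕ.≟ p
... | yes refl = primePowerWitness {a = suc a} pp (*-monoʳ-∣ p qᵃ∣m)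
                   (λ pᵃ⁺¹∣np → qᵃ∤n (*-cancelˡ-∣ p (subst (p ^ suc a ∣_) (ℕ.*-comm n p) pᵃ⁺¹∣np)))
  where instance _ = prime⇒nonZero pp
... | no q≢p = primePowerWitness {a = a} pq (∣-trans qᵃ∣m (n∣m*n p))
                 (λ qᵃ∣np → qᵃ∤n (prime^-divisor a pq (prime∤prime pq pp q≢p) (subst (q ^ a ∣_) (ℕ.*-comm n p) qᵃ∣np)))

product∤⇒primePowerWitness : ∀ {ps n} → All Prime ps → product ps ∤ n → PrimePowerWitness (product ps) n
product∤⇒primePowerWitness {[]}     {n} []         ∤n = contradiction (1∣ n) ∤n
product∤⇒primePowerWitness {p ∷ ps} {n} (pp ∷ pps) ∤n with p ∣? n
... | no p∤n = primePowerWitness {a = 1} pp (*-monoʳ-∣ p (1∣ product ps))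
                 (λ p*1∣n → p∤n (subst (_∣ n) (ℕ.*-identityʳ p) p*1∣n))
... | yes (divides n′ refl) = primePowerWitness-*-prime pp (product∤⇒primePowerWitness pps ps∤n′)
  where
  ps∤n′ : product ps ∤ n′
  ps∤n′ ps∣n′ = ∤n (subst (p ℕ.* product ps ∣_) (ℕ.*-comm p n′) (*-monoʳ-∣ p ps∣n′))

∤⇒primePowerWitness : ∀ {ℓ x} .{{_ : NonZero ℓ}} → ℓ ∤ x → PrimePowerWitness ℓ x
∤⇒primePowerWitness {ℓ} {x} ℓ∤x =
  subst (λ ℓ → PrimePowerWitness ℓ x) (sym ℓ≡∏) (product∤⇒primePowerWitness factorsPrime (subst (_∤ x) ℓ≡∏ ℓ∤x))
  where open PrimeFactorisation (factorise ℓ) renaming (isFactorisation to ℓ≡∏)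

primePowerWitness⇒∈primeDivisors : ∀ {ℓ x} .{{_ : NonZero ℓ}} (w : PrimePowerWitness ℓ x) →
                                   PrimePowerWitness.p w ∈ primeDivisors ℓ
primePowerWitness⇒∈primeDivisors {ℓ} {x} (primePowerWitness {p} {zero}  pp _    1∤x) = contradiction (1∣ x) 1∤x
primePowerWitness⇒∈primeDivisors {ℓ} {x} (primePowerWitness {p} {suc a} pp pᵃ∣ℓ _) =
  ∈-filter⁺ (λ q → prime? q ×-dec q ∣? ℓ) (∈-upTo⁺ (ℕ.s≤s (ℕ.∣⇒≤ p∣ℓ))) (pp , p∣ℓ)
  where p∣ℓ = ∣-trans (m∣m*n (p ^ a)) pᵃ∣ℓ

∈primeDivisors⇒prime : ∀ ℓ {q} → q ∈ primeDivisors ℓ → Prime q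
∈primeDivisors⇒prime ℓ q∈ = proj₁ (proj₂ (∈-filter⁻ (λ q → prime? q ×-dec q ∣? ℓ) {xs = upTo (suc ℓ)} q∈))

indicator : Subset n → Fin n → ℤ
indicator s x = if Vec.lookup s x then 1ℤ else 0ℤ

∣∩∣≡dot-indicator : (a b : Subset n) → ℤ.+ ∣ a ∩ b ∣ ≡ dot (indicator a) (indicator b)
∣∩∣≡dot-indicator Vec.[]      Vec.[]      = refl
∣∩∣≡dot-indicator (true ∷ a)  (true ∷ b)  = cong (1ℤ +_) (∣∩∣≡dot-indicator a b)
∣∩∣≡dot-indicator (true ∷ a)  (false ∷ b) = trans (∣∩∣≡dot-indicator a b) (sym (ℤ.+-identityˡ _))
∣∩∣≡dot-indicator (false ∷ a) (true ∷ b)  = trans (∣∩∣≡dot-indicator a b) (sym (ℤ.+-identityˡ _))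
∣∩∣≡dot-indicator (false ∷ a) (false ∷ b) = trans (∣∩∣≡dot-indicator a b) (sym (ℤ.+-identityˡ _))

relation⇒∑∣∩∣≡0 : (A : Fin k → Subset n) (c : Fin k → ℤ) → IsRelation c (indicator ∘ A) →
                  ∀ S → dot c (λ t → ℤ.+ ∣ A t ∩ S ∣) ≡ 0ℤ
relation⇒∑∣∩∣≡0 {k} {n} A c rel S = begin
  dot c (λ t → ℤ.+ ∣ A t ∩ S ∣)
    ≡⟨ sum-cong-≗ (λ t → cong (c t *_) (∣∩∣≡dot-indicator (A t) S)) ⟩
  sum (λ t → c t * sum (λ x → a t x * s x))
    ≡⟨ sum-cong-≗ (λ t → *-distribˡ-sum (c t) (λ x → a t x * s x)) ⟩
  sum (λ t → sum (λ x → c t * (a t x * s x)))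
    ≡⟨ ∑-comm (λ t x → c t * (a t x * s x)) ⟩
  sum (λ x → sum (λ t → c t * (a t x * s x)))
    ≡⟨ sum-cong-≗ (λ x → trans (sum-cong-≗ (λ t → sym (ℤ.*-assoc (c t) (a t x) (s x))))
                               (sym (*-distribʳ-sum (s x) (λ t → c t * a t x)))) ⟩
  sum (λ x → dot c (λ t → a t x) * s x)
    ≡⟨ sum-cong-≗ (λ x → cong (_* s x) (rel x)) ⟩
  sum {n} (λ _ → 0ℤ)
    ≡⟨ sum-replicate-zero n ⟩
  0ℤ ∎
  where
  open ≡-Reasoning
  a = indicator ∘ A
  s = indicator S

∣-sum : ∀ d (f : Fin k → ℤ) → (∀ t → d Signed.∣ f t) → d Signed.∣ sum f
∣-sum {zero}  d f d∣f = Signed.divides 0ℤ refl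
∣-sum {suc k} d f d∣f = Signed.∣m∣n⇒∣m+n (d∣f zero) (∣-sum d (f ∘ suc) (d∣f ∘ suc))

∣-sum-remove : ∀ d (f : Fin k → ℤ) j → d Signed.∣ sum f → (∀ t → t ≢ j → d Signed.∣ f t) → d Signed.∣ f j
∣-sum-remove {suc k} d f j d∣∑f d∣fₜ = Signed.∣m+n∣n⇒∣m (subst (d Signed.∣_) (sum-remove {i = j} f) d∣∑f)
  (∣-sum d (removeAt f j) (λ s → d∣fₜ (punchIn j s) (punchInᵢ≢i j s)))

prime-power-bound : ∀ {p} → Prime p → (a : Fin k → ℕ) (A B : Fin k → Subset n) →
                    (∀ i → p ^ a i ∤ ∣ A i ∩ B i ∣) → (∀ i j → i ≢ j → p ^ a j ∣ ∣ A i ∩ B j ∣) → k ≤ n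
prime-power-bound {k} {n} {p} pp a A B diag off with k ℕ.≤? n
... | yes k≤n = k≤n
... | no k≰n with c , rel , j , p∤cⱼ ← dependent⇒primitiveRelation p {{prime⇒nonTrivial pp}} (indicator ∘ A)
                                        (<⇒dependent (ℕ.≰⇒> k≰n) (indicator ∘ A)) =
  contradiction (prime^-divisor (a j) pp p∤cⱼ pᵃ∣cⱼMⱼ) (diag j)
  where
  M : Fin k → ℤ
  M t = ℤ.+ ∣ A t ∩ B j ∣
  +pᵃ∣cⱼMⱼ : ℤ.+ (p ^ a j) Signed.∣ c j * M j
  +pᵃ∣cⱼMⱼ = ∣-sum-remove _ (λ t → c t * M t) j
    (subst (ℤ.+ (p ^ a j) Signed.∣_) (sym (relation⇒∑∣∩∣≡0 A c rel (B j))) (Signed.divides 0ℤ refl))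
    (λ t t≢j → Signed.∣n⇒∣m*n (c t) (Signed.∣ᵤ⇒∣ (off t j t≢j)))
  pᵃ∣cⱼMⱼ : p ^ a j ∣ ℤ.∣ c j ∣ ℕ.* ∣ A j ∩ B j ∣
  pᵃ∣cⱼMⱼ = subst (p ^ a j ∣_) (ℤ.abs-* (c j) (M j)) (Signed.∣⇒∣ᵤ +pᵃ∣cⱼMⱼ)

Unique⇒lookup-injective : ∀ {A : Set} {xs : List A} → Unique xs → Injective _≡_ _≡_ (lookup xs)
Unique⇒lookup-injective {xs = _ ∷ _} (_    ∷ _) {zero}  {zero}  _  = refl
Unique⇒lookup-injective {xs = _ ∷ _} (x∉xs ∷ _) {zero}  {suc t} eq = contradiction eq (All.lookup x∉xs (∈-lookup t))
Unique⇒lookup-injective {xs = _ ∷ _} (x∉xs ∷ _) {suc s} {zero}  eq = contradiction (sym eq) (All.lookup x∉xs (∈-lookup s))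
Unique⇒lookup-injective {xs = _ ∷ _} (_    ∷ u) {suc s} {suc t} eq = cong suc (Unique⇒lookup-injective u eq)

length-filter-∁ : ∀ {A : Set} {P : A → Set} (P? : ∀ x → Dec (P x)) xs →
                  length xs ≡ length (filter P? xs) ℕ.+ length (filter (¬? ∘ P?) xs)
length-filter-∁ P? []       = refl
length-filter-∁ P? (x ∷ xs) with P? x
... | yes _ = cong suc (length-filter-∁ P? xs)
... | no  _ = trans (cong suc (length-filter-∁ P? xs)) (sym (ℕ.+-suc _ _))

module _ {A B : Set} (_≟_ : DecidableEquality B) (f : A → B) (n : ℕ) where

  length≤colours*fibre : ∀ bs → (∀ {b} → b ∈ bs → ∀ {ys} → Unique ys → All (λ y → f y ≡ b) ys → length ys ≤ n) →
                         ∀ {xs} → Unique xs → All (λ x → f x ∈ bs) xs → length xs ≤ length bs ℕ.* n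
  length≤colours*fibre []       _     {[]}    _ _          = ℕ.z≤n
  length≤colours*fibre []       _     {_ ∷ _} _ (() ∷ _)
  length≤colours*fibre (b ∷ bs) fibre {xs}    u f[xs]⊆b∷bs = begin
    length xs                                   ≡⟨ length-filter-∁ is-b? xs ⟩
    length (filter is-b? xs) ℕ.+ length others  ≤⟨ ℕ.+-mono-≤ (fibre (here refl) (Unique.filter⁺ is-b? u) (All.all-filter is-b? xs))
                                                     (length≤colours*fibre bs (fibre ∘ there) (Unique.filter⁺ (¬? ∘ is-b?) u) f[others]⊆bs) ⟩
    n ℕ.+ length bs ℕ.* n                       ∎
    where
    open ℕ.≤-Reasoning
    is-b? = λ x → f x ≟ b
    others = filter (¬? ∘ is-b?) xs
    drop-b : ∀ {x} → f x ∈ b ∷ bs × f x ≢ b → f x ∈ bs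
    drop-b (here fx≡b , fx≢b) = contradiction fx≡b fx≢b
    drop-b (there fx∈bs , _)  = fx∈bs
    f[others]⊆bs : All (λ x → f x ∈ bs) others
    f[others]⊆bs = All.zipWith drop-b (All.filter⁺ (¬? ∘ is-b?) f[xs]⊆b∷bs , All.all-filter (¬? ∘ is-b?) xs)

pigeonhole-fibres : ∀ {B : Set} → DecidableEquality B → (f : Fin m → B) (bs : List B) → (∀ i → f i ∈ bs) →
                    (∀ {b} → b ∈ bs → ∀ {k} (g : Fin k → Fin m) → Injective _≡_ _≡_ g → (∀ t → f (g t) ≡ b) → k ≤ n) →
                    m ≤ length bs ℕ.* n
pigeonhole-fibres {m} {n} _≟_ f bs f⊆bs fibre =
  subst (_≤ length bs ℕ.* n) (length-tabulate {n = m} (λ i → i))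
    (length≤colours*fibre _≟_ f n bs
      (λ b∈bs {ys} u f[ys]≡b → fibre b∈bs (lookup ys) (Unique⇒lookup-injective u) (λ t → All.lookup f[ys]≡b (∈-lookup t)))
      (Unique.allFin⁺ m) (All.tabulate (λ {i} _ → f⊆bs i)))

lemma4p1 : (ℓ m n : ℕ) → .{{NonZero ℓ}} → .{{NonZero m}} → .{{NonZero n}} →
           (A B : Fin m → Subset n) →
           (∀ i → ¬ (ℓ ∣ ∣ A i ∩ B i ∣)) →
           (∀ i j → i ≢ j → ℓ ∣ ∣ A i ∩ B j ∣) →
           m ≤ numPrimeDivisors ℓ ℕ.* n
lemma4p1 ℓ m n A B ℓ∤AᵢBᵢ ℓ∣AᵢBⱼ =
  pigeonhole-fibres ℕ._≟_ (PrimePowerWitness.p ∘ witness) (primeDivisors ℓ)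
    (primePowerWitness⇒∈primeDivisors ∘ witness) fibre-bound
  where
  witness : ∀ i → PrimePowerWitness ℓ ∣ A i ∩ B i ∣
  witness i = ∤⇒primePowerWitness (ℓ∤AᵢBᵢ i)
  open PrimePowerWitness

  fibre-bound : ∀ {q} → q ∈ primeDivisors ℓ → ∀ {k} (g : Fin k → Fin m) → Injective _≡_ _≡_ g →
                (∀ t → p (witness (g t)) ≡ q) → k ≤ n
  fibre-bound {q} q∈ g g-injective pₜ≡q =
    prime-power-bound (∈primeDivisors⇒prime ℓ q∈)
      (a ∘ witness ∘ g) (A ∘ g) (B ∘ g) diagonal off-diagonal
    where
    diagonal : ∀ t → q ^ a (witness (g t)) ∤ ∣ A (g t) ∩ B (g t) ∣
    diagonal t = subst (λ r → r ^ a (witness (g t)) ∤ ∣ A (g t) ∩ B (g t) ∣) (pₜ≡q t) (pᵃ∤x (witness (g t)))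
    off-diagonal : ∀ s t → s ≢ t → q ^ a (witness (g t)) ∣ ∣ A (g s) ∩ B (g t) ∣
    off-diagonal s t s≢t = ∣-trans (subst (λ r → r ^ a (witness (g t)) ∣ ℓ) (pₜ≡q t) (pᵃ∣ℓ (witness (g t))))
                                   (ℓ∣AᵢBⱼ (g s) (g t) (s≢t ∘ g-injective))
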